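{- Let $D$ be a set of nonnegative integers, let $\delta_0, \dots, \delta_{n-1}$ be positive integers with $\sum_{i=0}^{n-1} \delta_i = m$, and for $0 \leq i \leq n-1$ let $\sigma_i = \delta_0 + \delta_1 + \cdots + \delta_i$. Let $S = \{s_0 < s_1 < s_2 < \cdots\}$ be a set of nonnegative integers whose consecutive differences are periodic with period $(\delta_0,\dots,\delta_{n-1})$, i.e. $s_{\ell+1} - s_\ell = \delta_{\ell \bmod n}$ for all $\ell \geq 0$. Then $S$ is a $D$-sequence if and only if the map $f$ on $\mathbb{Z}$ given by $f(v) = \{(v + \sigma_i) \bmod m : 0 \leq i \leq n-1\}$ (an $n$-element subset of $\mathbb{Z}_m$) is an $(m/n)$-coloring of the distance graph $G(\mathbb{Z}, D)$.
   Context: A $D$-sequence is a set $S$ of nonnegative integers such that $|x-y| \notin D$ for all $x,y \in S$. The distance graph $G(\mathbb{Z},D)$ has vertex set $\mathbb{Z}$, with $u,v$ adjacent whenever $|u-v| \in D$. An $(m/n)$-coloring of a graph assigns to each vertex an $n$-element subset of an $m$-element set of colors (here $\mathbb{Z}_m$) such that adjacent vertices receive disjoint subsets. -}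

module Defs where

open import Data.Nat as ℕ using (ℕ; zero; suc; _+_; _<_; NonZero; ∣_-_∣)
open import Data.Integer as ℤ using (ℤ)
open import Data.Integer.DivMod using (_%ℕ_; n%ℕd<d)
open import Data.Fin using (Fin; zero; suc; fromℕ<)
open import Data.Fin.Subset as Sub using (Subset; ⁅_⁆; ⋃; _∩_)
open import Data.List using (List; map; allFin)
open import Data.Nat.ListAction using (sum)
open import Data.Product using (_×_)
open import Relation.Nullary using (¬_)
open import Relation.Binary.PropositionalEquality using (_≡_)

total : ∀ {n} → (Fin n → ℕ) → ℕ
total {n} δ = sum (map δ (allFin n))

σ : ∀ {n} → (Fin n → ℕ) → Fin n → ℕ
σ δ zero    = δ zero
σ δ (suc i) = δ zero + σ (λ j → δ (suc j)) i

total-nonZero : ∀ {n} .{{_ : NonZero n}} (δ : Fin n → ℕ) →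
                (∀ i → 0 < δ i) → NonZero (total δ)
total-nonZero {suc n} δ pos with δ zero | pos zero
... | suc k | _ = _

residue : (m : ℕ) .{{_ : NonZero m}} → ℤ → Fin m
residue m v = fromℕ< (n%ℕd<d v m)

-- S = {s_0, s_1, ...} (given by s : ℕ → ℕ) is a D-sequence:
-- |x - y| ∉ D for all x, y ∈ S
IsDSequence : (D : ℕ → Set) → (ℕ → ℕ) → Set
IsDSequence D s = ∀ k l → ¬ D ∣ s k - s l ∣

Adj : (D : ℕ → Set) → ℤ → ℤ → Set
Adj D u v = D ℤ.∣ u ℤ.- v ∣

-- (m/n)-coloring of G(ℤ, D) with colour set ℤ_m = Fin m:
-- each vertex gets an n-element subset, adjacent vertices get disjoint subsets
IsColoring : (D : ℕ → Set) (m n : ℕ) → (ℤ → Subset m) → Set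
IsColoring D m n c =
  (∀ v → Sub.∣ c v ∣ ≡ n) × (∀ u v → Adj D u v → Sub.Empty (c u ∩ c v))

colorMap : ∀ {n} .{{_ : NonZero n}} (δ : Fin n → ℕ) → (∀ i → 0 < δ i) →
           ℤ → Subset (total δ)
colorMap {n} δ pos v =
  ⋃ (map (λ i → ⁅ residue (total δ) {{total-nonZero δ pos}} (v ℤ.+ ℤ.+ σ δ i) ⁆) (allFin n))

module Submission where

-- Write m = total δ. The recurrence gives the closed form s (q n + 1 + i) = s 0 + q m + σ i,
-- so modulo m the elements of S are exactly the translates s 0 + σ i. The colour sets f(u) and
-- f(v) meet iff u + σ i ≡ v + σ j (mod m) for some i, j; writing u = v + d with d ≥ 0, the
-- bounds 1 ≤ σ i ≤ m force d + σ i = σ j + t m with t ≥ 0, so d = s (t n + 1 + j) − s (1 + i)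
-- is a distance within S. Conversely the distance between s k and s l is realised by these two
-- vertices, whose colour sets share (s 0 + σ i + σ j) mod m. The same bounds make the σ i
-- distinct modulo m, so f(v) has n elements.

open import Defs
open import Data.Nat as ℕ using (ℕ; zero; suc; _+_; _*_; _∸_; _<_; _≤_; NonZero; s≤s; _%_; _/_)
open import Data.Nat.Properties hiding (suc-injective)
open import Data.Nat.DivMod using (_mod_; m%n<n; m≡m%n+[m/n]*n; [m+n]%n≡m%n; [m+kn]%n≡m%n; m<n⇒m%n≡m)
open import Data.Nat.ListAction using (sum)
open import Data.Fin using (Fin; zero; suc; toℕ; fromℕ; fromℕ<)
open import Data.Fin.Properties using (toℕ-injective; toℕ-fromℕ<; toℕ<n; toℕ-fromℕ; suc-injective)
open import Data.Fin.Subset as Sub using (Subset; ⁅_⁆; ⋃; _∪_; _∩_; _∈_; _∉_; inside; outside)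
open import Data.Fin.Subset.Properties using (x∈⁅x⁆; x∈⁅y⁆⇒x≡y; x∈p∪q⁻; x∈p∪q⁺; x∈p∩q⁺; x∈p∩q⁻; ∉⊥; ∣⊥∣≡0; ∪-identityˡ)
open import Data.List using (tabulate)
open import Data.List.Properties using (map-tabulate)
open import Data.Vec using (_∷_; here; there)
open import Data.Product using (∃; ∃₂; _,_)
open import Data.Sum using (inj₁; inj₂)
open import Data.Empty using (⊥-elim)
open import Function using (_∘_)
open import Data.Nat.Tactic.RingSolver using (solve-∀)
open import Algebra.Properties.CommutativeSemigroup +-commutativeSemigroup using (xy∙z≈xz∙y)
open import Function.Definitions using (Injective)
open import Function.Bundles using (_⇔_; mk⇔)
open import Relation.Binary.PropositionalEquality

image : ∀ {n m} → (Fin n → Fin m) → Subset m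
image f = ⋃ (tabulate (⁅_⁆ ∘ f))

∈-image⁺ : ∀ {n m} (f : Fin n → Fin m) i → f i ∈ image f
∈-image⁺ f zero    = x∈p∪q⁺ (inj₁ (x∈⁅x⁆ (f zero)))
∈-image⁺ f (suc i) = x∈p∪q⁺ (inj₂ (∈-image⁺ (f ∘ suc) i))

∈-image⁻ : ∀ {n m} (f : Fin n → Fin m) {x} → x ∈ image f → ∃ λ i → x ≡ f i
∈-image⁻ {zero}  f x∈ = ⊥-elim (∉⊥ x∈)
∈-image⁻ {suc n} f x∈ with x∈p∪q⁻ ⁅ f zero ⁆ (image (f ∘ suc)) x∈
... | inj₁ x∈⁅f0⁆ = zero , x∈⁅y⁆⇒x≡y (f zero) x∈⁅f0⁆
... | inj₂ x∈rest with ∈-image⁻ (f ∘ suc) x∈rest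
...   | i , x≡fi = suc i , x≡fi

∣⁅x⁆∪p∣≡1+∣p∣ : ∀ {m} (x : Fin m) (p : Subset m) → x ∉ p → Sub.∣ ⁅ x ⁆ ∪ p ∣ ≡ suc Sub.∣ p ∣
∣⁅x⁆∪p∣≡1+∣p∣ zero    (inside  ∷ p) x∉p = ⊥-elim (x∉p here)
∣⁅x⁆∪p∣≡1+∣p∣ zero    (outside ∷ p) x∉p = cong (suc ∘ Sub.∣_∣) (∪-identityˡ p)
∣⁅x⁆∪p∣≡1+∣p∣ (suc x) (inside  ∷ p) x∉p = cong suc (∣⁅x⁆∪p∣≡1+∣p∣ x p (x∉p ∘ there))
∣⁅x⁆∪p∣≡1+∣p∣ (suc x) (outside ∷ p) x∉p = ∣⁅x⁆∪p∣≡1+∣p∣ x p (x∉p ∘ there)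

∣image∣≡n : ∀ {n m} (f : Fin n → Fin m) → Injective _≡_ _≡_ f → Sub.∣ image f ∣ ≡ n
∣image∣≡n {zero}  {m} f _     = ∣⊥∣≡0 m
∣image∣≡n {suc n} f f-inj =
  trans (∣⁅x⁆∪p∣≡1+∣p∣ (f zero) (image (f ∘ suc)) f0∉rest)
        (cong suc (∣image∣≡n (f ∘ suc) (suc-injective ∘ f-inj)))
  where
  f0∉rest : f zero ∉ image (f ∘ suc)
  f0∉rest f0∈ with ∈-image⁻ (f ∘ suc) f0∈
  ... | i , f0≡fsi with f-inj f0≡fsi
  ...   | ()

-- δ 0 + ⋯ + δ (r − 1) for r ≤ n; unlike σ it has the empty prefix r = 0
prefixSum : ∀ {n} → (Fin n → ℕ) → ℕ → ℕ
prefixSum         δ zero    = 0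
prefixSum {zero}  δ (suc r) = 0
prefixSum {suc n} δ (suc r) = δ zero + prefixSum (δ ∘ suc) r

prefixSum-suc : ∀ {n} (δ : Fin n → ℕ) {r} (r<n : r < n) →
                prefixSum δ (suc r) ≡ prefixSum δ r + δ (fromℕ< r<n)
prefixSum-suc {suc n} δ {zero}  _         = +-comm (δ zero) 0
prefixSum-suc {suc n} δ {suc r} (s≤s r<n) =
  trans (cong (δ zero +_) (prefixSum-suc (δ ∘ suc) r<n)) (sym (+-assoc (δ zero) _ _))

total≡sum-tabulate : ∀ {n} (δ : Fin n → ℕ) → total δ ≡ sum (tabulate δ)
total≡sum-tabulate δ = cong sum (map-tabulate (λ i → i) δ)

prefixSum-total : ∀ {n} (δ : Fin n → ℕ) → prefixSum δ n ≡ total δ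
prefixSum-total δ = trans (go δ) (sym (total≡sum-tabulate δ))
  where
  go : ∀ {n} (δ : Fin n → ℕ) → prefixSum δ n ≡ sum (tabulate δ)
  go {zero}  δ = refl
  go {suc n} δ = cong (δ zero +_) (go (δ ∘ suc))

σ≡prefixSum : ∀ {n} (δ : Fin n → ℕ) i → σ δ i ≡ prefixSum δ (suc (toℕ i))
σ≡prefixSum δ zero    = sym (+-identityʳ (δ zero))
σ≡prefixSum δ (suc i) = cong (δ zero +_) (σ≡prefixSum (δ ∘ suc) i)

σ-last : ∀ {n} (δ : Fin (suc n) → ℕ) → σ δ (fromℕ n) ≡ total δ
σ-last {n} δ = begin
  σ δ (fromℕ n)                    ≡⟨ σ≡prefixSum δ (fromℕ n) ⟩
  prefixSum δ (suc (toℕ (fromℕ n))) ≡⟨ cong (prefixSum δ ∘ suc) (toℕ-fromℕ n) ⟩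
  prefixSum δ (suc n)              ≡⟨ prefixSum-total δ ⟩
  total δ                          ∎
  where open ≡-Reasoning

σ≤total : ∀ {n} (δ : Fin n → ℕ) i → σ δ i ≤ total δ
σ≤total δ i = subst (σ δ i ≤_) (sym (total≡sum-tabulate δ)) (go δ i)
  where
  go : ∀ {n} (δ : Fin n → ℕ) i → σ δ i ≤ sum (tabulate δ)
  go δ zero    = m≤m+n (δ zero) _
  go δ (suc i) = +-monoʳ-≤ (δ zero) (go (δ ∘ suc) i)

σ-positive : ∀ {n} (δ : Fin n → ℕ) → (∀ i → 0 < δ i) → ∀ i → 0 < σ δ i
σ-positive δ pos zero    = pos zero
σ-positive δ pos (suc i) = ≤-trans (pos zero) (m≤m+n (δ zero) _)

σ-zero<σ-suc : ∀ {n} (δ : Fin (suc n) → ℕ) → (∀ i → 0 < δ i) → ∀ i → σ δ zero < σ δ (suc i)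
σ-zero<σ-suc δ pos i = m<m+n (δ zero) (σ-positive (δ ∘ suc) (pos ∘ suc) i)

σ-injective : ∀ {n} (δ : Fin n → ℕ) → (∀ i → 0 < δ i) → Injective _≡_ _≡_ (σ δ)
σ-injective δ pos {zero}  {zero}  _ = refl
σ-injective δ pos {zero}  {suc j} e = ⊥-elim (<⇒≢ (σ-zero<σ-suc δ pos j) e)
σ-injective δ pos {suc i} {zero}  e = ⊥-elim (<⇒≢ (σ-zero<σ-suc δ pos i) (sym e))
σ-injective δ pos {suc i} {suc j} e =
  cong suc (σ-injective (δ ∘ suc) (pos ∘ suc) (+-cancelˡ-≡ (δ zero) _ _ e))

σ≡σ+t*total⇒≡ : ∀ {n} (δ : Fin n → ℕ) → (∀ i → 0 < δ i) →
                 ∀ {i j} t → σ δ i ≡ σ δ j + t * total δ → i ≡ j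
σ≡σ+t*total⇒≡ δ pos {i} {j} zero    e = σ-injective δ pos (trans e (+-identityʳ (σ δ j)))
σ≡σ+t*total⇒≡ δ pos {i} {j} (suc t) e = ⊥-elim (<⇒≱ σi>total (σ≤total δ i))
  where
  σi>total : total δ < σ δ i
  σi>total = begin-strict
    total δ                 <⟨ m<n+m (total δ) (σ-positive δ pos j) ⟩
    σ δ j + total δ         ≤⟨ +-monoʳ-≤ (σ δ j) (m≤m+n (total δ) (t * total δ)) ⟩
    σ δ j + suc t * total δ ≡⟨ e ⟨
    σ δ i                   ∎
    where open ≤-Reasoning

[q*n+r]mod-n≡r : ∀ q {n r} .{{_ : NonZero n}} (r<n : r < n) → (q * n + r) mod n ≡ fromℕ< r<n
[q*n+r]mod-n≡r q {n} {r} r<n = toℕ-injective (begin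
  toℕ ((q * n + r) mod n) ≡⟨ toℕ-fromℕ< (m%n<n (q * n + r) n) ⟩
  (q * n + r) % n         ≡⟨ cong (_% n) (+-comm (q * n) r) ⟩
  (r + q * n) % n         ≡⟨ [m+kn]%n≡m%n r q n ⟩
  r % n                   ≡⟨ m<n⇒m%n≡m r<n ⟩
  r                       ≡⟨ toℕ-fromℕ< r<n ⟨
  toℕ (fromℕ< r<n)        ∎)
  where open ≡-Reasoning

%-shift : ∀ {a b m} q .{{_ : NonZero m}} → a + m ≡ b + q * m → ∀ x → (a + x) % m ≡ (b + x) % m
%-shift {a} {b} {m} q a+m≡b+qm x = begin
  (a + x) % m           ≡⟨ [m+n]%n≡m%n (a + x) m ⟨
  (a + x + m) % m       ≡⟨ cong (_% m) (xy∙z≈xz∙y a x m) ⟩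
  (a + m + x) % m       ≡⟨ cong (λ y → (y + x) % m) a+m≡b+qm ⟩
  (b + q * m + x) % m   ≡⟨ cong (_% m) (xy∙z≈xz∙y b (q * m) x) ⟩
  (b + x + q * m) % m   ≡⟨ [m+kn]%n≡m%n (b + x) q m ⟩
  (b + x) % m           ∎
  where open ≡-Reasoning

module IntegerArithmetic where

  open import Data.Integer as ℤ using (+_; -[1+_]; _%ℕ_; _/ℕ_)
  import Data.Integer.Properties as ℤP
  open import Data.Integer.DivMod using (a≡a%ℕn+[a/ℕn]*n)
  import Data.Integer.Tactic.RingSolver as ℤSolver

  [x-y]≡[x/m-y/m]*m : ∀ {m} .{{_ : NonZero m}} x y → x %ℕ m ≡ y %ℕ m →
                      x ℤ.- y ≡ (x /ℕ m ℤ.- y /ℕ m) ℤ.* + m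
  [x-y]≡[x/m-y/m]*m {m} x y eq = begin
    x ℤ.- y                                       ≡⟨ cong₂ ℤ._-_ (a≡a%ℕn+[a/ℕn]*n x m) (a≡a%ℕn+[a/ℕn]*n y m) ⟩
    (+ rx ℤ.+ qx ℤ.* M) ℤ.- (+ ry ℤ.+ qy ℤ.* M)   ≡⟨ cong (λ r → (+ rx ℤ.+ qx ℤ.* M) ℤ.- (+ r ℤ.+ qy ℤ.* M)) eq ⟨
    (+ rx ℤ.+ qx ℤ.* M) ℤ.- (+ rx ℤ.+ qy ℤ.* M)   ≡⟨ difference-of-multiples (+ rx) qx qy M ⟩
    (qx ℤ.- qy) ℤ.* M                             ∎
    where
    open ≡-Reasoning
    M = + m
    rx = x %ℕ m
    ry = y %ℕ m
    qx = x /ℕ m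
    qy = y /ℕ m
    difference-of-multiples : ∀ r p q w → (r ℤ.+ p ℤ.* w) ℤ.- (r ℤ.+ q ℤ.* w) ≡ (p ℤ.- q) ℤ.* w
    difference-of-multiples = ℤSolver.solve-∀

  residue-offsets-differ-by-multiple :
    ∀ {m} .{{_ : NonZero m}} v a b → (v ℤ.+ + a) %ℕ m ≡ (v ℤ.+ + b) %ℕ m →
    ∃ λ k → + a ≡ + b ℤ.+ k ℤ.* + m
  residue-offsets-differ-by-multiple {m} v a b eq =
    (v ℤ.+ + a) /ℕ m ℤ.- (v ℤ.+ + b) /ℕ m , trans (insert-difference (+ a) (+ b) v)
              (cong (λ z → + b ℤ.+ z) ([x-y]≡[x/m-y/m]*m (v ℤ.+ + a) (v ℤ.+ + b) eq))
    where
    insert-difference : ∀ x y v → x ≡ y ℤ.+ ((v ℤ.+ x) ℤ.- (v ℤ.+ y))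
    insert-difference = ℤSolver.solve-∀

  bounded-offsets-differ-by-natural-multiple :
    ∀ {a b m} k → 0 < a → b ≤ m → + a ≡ + b ℤ.+ k ℤ.* + m → ∃ λ t → a ≡ b + t * m
  bounded-offsets-differ-by-natural-multiple {a} {b} {m} (+ t) _ _ e =
    t , ℤP.+-injective (trans e (cong (λ z → + b ℤ.+ z) (sym (ℤP.pos-* t m))))
  bounded-offsets-differ-by-natural-multiple {a} {b} {m} -[1+ t ] 0<a b≤m e =
    ⊥-elim (<⇒≢ b<a+[1+t]m (ℤP.+-injective b≡a+[1+t]m))
    where
    move : ∀ x y z w → x ≡ y ℤ.+ (ℤ.- z) ℤ.* w → y ≡ x ℤ.+ z ℤ.* w
    move x y z w e = trans (rearrange y z w) (cong (ℤ._+ z ℤ.* w) (sym e))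
      where rearrange : ∀ y z w → y ≡ y ℤ.+ (ℤ.- z) ℤ.* w ℤ.+ z ℤ.* w
            rearrange = ℤSolver.solve-∀
    b≡a+[1+t]m : + b ≡ + (a + suc t * m)
    b≡a+[1+t]m = trans (move (+ a) (+ b) (+ suc t) (+ m) e)
                       (cong (λ z → + a ℤ.+ z) (sym (ℤP.pos-* (suc t) m)))
    b<a+[1+t]m : b < a + suc t * m
    b<a+[1+t]m = ≤-<-trans b≤m (<-≤-trans (m<n+m m 0<a) (+-monoʳ-≤ a (m≤m+n m (t * m))))

  ∣+m-+n∣≡∣m-n∣ : ∀ a b → ℤ.∣ + a ℤ.- + b ∣ ≡ ℕ.∣ a - b ∣
  ∣+m-+n∣≡∣m-n∣ a b with ≤-total a b
  ... | inj₁ a≤b = begin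
    ℤ.∣ + a ℤ.- + b ∣ ≡⟨ cong ℤ.∣_∣ (ℤP.m-n≡m⊖n a b) ⟩
    ℤ.∣ a ℤ.⊖ b ∣     ≡⟨ ℤP.∣⊖∣-≤ a≤b ⟩
    b ∸ a             ≡⟨ m≤n⇒∣m-n∣≡n∸m a≤b ⟨
    ℕ.∣ a - b ∣       ∎
    where open ≡-Reasoning
  ... | inj₂ b≤a = begin
    ℤ.∣ + a ℤ.- + b ∣ ≡⟨ cong ℤ.∣_∣ (ℤP.m-n≡m⊖n a b) ⟩
    ℤ.∣ a ℤ.⊖ b ∣     ≡⟨ ℤP.∣m⊖n∣≡∣n⊖m∣ a b ⟩
    ℤ.∣ b ℤ.⊖ a ∣     ≡⟨ ℤP.∣⊖∣-≤ b≤a ⟩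
    a ∸ b             ≡⟨ m≤n⇒∣m-n∣≡n∸m b≤a ⟨
    ℕ.∣ b - a ∣       ≡⟨ ∣-∣-comm b a ⟩
    ℕ.∣ a - b ∣       ∎
    where open ≡-Reasoning

  i≤j⇒j≡i+∣j-i∣ : ∀ {i j} → i ℤ.≤ j → j ≡ i ℤ.+ + ℤ.∣ j ℤ.- i ∣
  i≤j⇒j≡i+∣j-i∣ {i} {j} i≤j = begin
    j                     ≡⟨ add-difference i j ⟩
    i ℤ.+ (j ℤ.- i)       ≡⟨ cong (λ z → i ℤ.+ z) +∣j-i∣≡j-i ⟨
    i ℤ.+ + ℤ.∣ j ℤ.- i ∣ ∎
    where
    open ≡-Reasoning
    +∣j-i∣≡j-i : + ℤ.∣ j ℤ.- i ∣ ≡ j ℤ.- i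
    +∣j-i∣≡j-i = trans (cong +_ (ℤP.∣i-j∣≡∣j-i∣ j i)) (ℤP.∣-∣-≤ i≤j)
    add-difference : ∀ i j → j ≡ i ℤ.+ (j ℤ.- i)
    add-difference = ℤSolver.solve-∀

module PeriodicSequence {n′} (δ : Fin (suc n′) → ℕ) (s : ℕ → ℕ)
                        (s-step : ∀ l → s (suc l) ≡ s l + δ (l mod suc n′)) where

  private
    n = suc n′
    m = total δ

  s-within-period : ∀ q {r} → r ≤ n → s (q * n + r) ≡ s (q * n) + prefixSum δ r
  s-within-period q {zero}  _   = trans (cong s (+-identityʳ (q * n))) (sym (+-identityʳ _))
  s-within-period q {suc r} r<n = begin
    s (q * n + suc r)                          ≡⟨ cong s (+-suc (q * n) r) ⟩
    s (suc (q * n + r))                        ≡⟨ s-step (q * n + r) ⟩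
    s (q * n + r) + δ ((q * n + r) mod n)      ≡⟨ cong₂ _+_ (s-within-period q (<⇒≤ r<n))
                                                            (cong δ ([q*n+r]mod-n≡r q r<n)) ⟩
    s (q * n) + prefixSum δ r + δ (fromℕ< r<n) ≡⟨ +-assoc (s (q * n)) _ _ ⟩
    s (q * n) + (prefixSum δ r + δ (fromℕ< r<n)) ≡⟨ cong (s (q * n) +_) (prefixSum-suc δ r<n) ⟨
    s (q * n) + prefixSum δ (suc r)            ∎
    where open ≡-Reasoning

  s-period : ∀ q → s (q * n) ≡ s 0 + q * m
  s-period zero    = sym (+-identityʳ (s 0))
  s-period (suc q) = begin
    s (n + q * n)               ≡⟨ cong s (+-comm n (q * n)) ⟩
    s (q * n + n)               ≡⟨ s-within-period q ≤-refl ⟩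
    s (q * n) + prefixSum δ n   ≡⟨ cong₂ _+_ (s-period q) (prefixSum-total δ) ⟩
    s 0 + q * m + m             ≡⟨ +-assoc (s 0) (q * m) m ⟩
    s 0 + (q * m + m)           ≡⟨ cong (s 0 +_) (+-comm (q * m) m) ⟩
    s 0 + (m + q * m)           ∎
    where open ≡-Reasoning

  s-closed-form : ∀ q i → s (q * n + suc (toℕ i)) ≡ s 0 + q * m + σ δ i
  s-closed-form q i = begin
    s (q * n + suc (toℕ i))              ≡⟨ s-within-period q (toℕ<n i) ⟩
    s (q * n) + prefixSum δ (suc (toℕ i)) ≡⟨ cong₂ _+_ (s-period q) (sym (σ≡prefixSum δ i)) ⟩
    s 0 + q * m + σ δ i                  ∎
    where open ≡-Reasoning

  s-residue : ∀ k → ∃₂ λ i q → s k + m ≡ s 0 + σ δ i + q * m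
  s-residue zero     = fromℕ n′ , 0 , trans (cong (s 0 +_) (sym (σ-last δ))) (sym (+-identityʳ _))
  s-residue (suc k) = k mod n , suc (k / n) , (begin
    s (suc k) + m                                   ≡⟨ cong (λ l → s l + m) suc-k≡ ⟩
    s (k / n * n + suc (toℕ (k mod n))) + m        ≡⟨ cong (_+ m) (s-closed-form (k / n) (k mod n)) ⟩
    s 0 + k / n * m + σ δ (k mod n) + m            ≡⟨ shuffle (s 0) (k / n) (σ δ (k mod n)) m ⟩
    s 0 + σ δ (k mod n) + suc (k / n) * m          ∎)
    where
    open ≡-Reasoning
    shuffle : ∀ a b c d → a + b * d + c + d ≡ a + c + suc b * d
    shuffle = solve-∀
    suc-k≡ : suc k ≡ k / n * n + suc (toℕ (k mod n))
    suc-k≡ = begin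
      suc k                        ≡⟨ cong suc (m≡m%n+[m/n]*n k n) ⟩
      suc (k % n + k / n * n)      ≡⟨ cong suc (+-comm (k % n) (k / n * n)) ⟩
      suc (k / n * n + k % n)      ≡⟨ +-suc (k / n * n) (k % n) ⟨
      k / n * n + suc (k % n)      ≡⟨ cong (λ r → k / n * n + suc r) (toℕ-fromℕ< (m%n<n k n)) ⟨
      k / n * n + suc (toℕ (k mod n)) ∎

  distance-realised : ∀ {d} i j t → d + σ δ i ≡ σ δ j + t * m →
                      ℕ.∣ s (suc (toℕ i)) - s (t * n + suc (toℕ j)) ∣ ≡ d
  distance-realised {d} i j t e = begin
    ℕ.∣ s (suc (toℕ i)) - s (t * n + suc (toℕ j)) ∣ ≡⟨ cong (λ x → ℕ.∣ s (suc (toℕ i)) - x ∣) far ⟩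
    ℕ.∣ s (suc (toℕ i)) - s (suc (toℕ i)) + d ∣     ≡⟨ ∣m-m+n∣≡n (s (suc (toℕ i))) d ⟩
    d                                               ∎
    where
    open ≡-Reasoning
    near : s (suc (toℕ i)) ≡ s 0 + σ δ i
    near = trans (s-closed-form 0 i) (cong (_+ σ δ i) (+-identityʳ (s 0)))
    far : s (t * n + suc (toℕ j)) ≡ s (suc (toℕ i)) + d
    far = begin
      s (t * n + suc (toℕ j)) ≡⟨ s-closed-form t j ⟩
      s 0 + t * m + σ δ j     ≡⟨ +-assoc (s 0) (t * m) (σ δ j) ⟩
      s 0 + (t * m + σ δ j)   ≡⟨ cong (s 0 +_) (trans (+-comm (t * m) (σ δ j)) (sym e)) ⟩
      s 0 + (d + σ δ i)       ≡⟨ cong (s 0 +_) (+-comm d (σ δ i)) ⟩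
      s 0 + (σ δ i + d)       ≡⟨ +-assoc (s 0) (σ δ i) d ⟨
      s 0 + σ δ i + d         ≡⟨ cong (_+ d) near ⟨
      s (suc (toℕ i)) + d     ∎

module Colouring {n′} (δ : Fin (suc n′) → ℕ) (pos : ∀ i → 0 < δ i) where

  open import Data.Integer as ℤ using (ℤ; +_; _%ℕ_)
  import Data.Integer.Properties as ℤP
  open IntegerArithmetic

  private
    m = total δ

  instance
    total-δ-nonZero : NonZero m
    total-δ-nonZero = total-nonZero δ pos

  colour : ℤ → Fin (suc n′) → Fin m
  colour v i = residue m (v ℤ.+ + σ δ i)

  toℕ-colour : ∀ v i → toℕ (colour v i) ≡ (v ℤ.+ + σ δ i) %ℕ m
  toℕ-colour v i = toℕ-fromℕ< _

  colorMap≡image : ∀ v → colorMap δ pos v ≡ image (colour v)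
  colorMap≡image v = cong ⋃ (map-tabulate (λ i → i) (⁅_⁆ ∘ colour v))

  ∈-colorMap⁺ : ∀ v i → colour v i ∈ colorMap δ pos v
  ∈-colorMap⁺ v i = subst (colour v i ∈_) (sym (colorMap≡image v)) (∈-image⁺ (colour v) i)

  ∈-colorMap⁻ : ∀ v {x} → x ∈ colorMap δ pos v → ∃ λ i → x ≡ colour v i
  ∈-colorMap⁻ v {x} x∈ = ∈-image⁻ (colour v) (subst (x ∈_) (colorMap≡image v) x∈)

  colour-coincidence : ∀ v d i j → colour (v ℤ.+ + d) i ≡ colour v j →
                       ∃ λ t → d + σ δ i ≡ σ δ j + t * m
  colour-coincidence v d i j same =
    let k , e = residue-offsets-differ-by-multiple v (d + σ δ i) (σ δ j) residues-equal
    in bounded-offsets-differ-by-natural-multiple k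
         (≤-trans (σ-positive δ pos i) (m≤n+m (σ δ i) d)) (σ≤total δ j) e
    where
    residues-equal : (v ℤ.+ + (d + σ δ i)) %ℕ m ≡ (v ℤ.+ + σ δ j) %ℕ m
    residues-equal = begin
      (v ℤ.+ + (d + σ δ i)) %ℕ m      ≡⟨ cong (_%ℕ m) (ℤP.+-assoc v (+ d) (+ σ δ i)) ⟨
      (v ℤ.+ + d ℤ.+ + σ δ i) %ℕ m    ≡⟨ toℕ-colour (v ℤ.+ + d) i ⟨
      toℕ (colour (v ℤ.+ + d) i)      ≡⟨ cong toℕ same ⟩
      toℕ (colour v j)                ≡⟨ toℕ-colour v j ⟩
      (v ℤ.+ + σ δ j) %ℕ m            ∎
      where open ≡-Reasoning

  colour-injective : ∀ v → Injective _≡_ _≡_ (colour v)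
  colour-injective v {i} {j} same =
    let t , e = colour-coincidence v 0 i j (subst (λ u → colour u i ≡ colour v j) (sym (ℤP.+-identityʳ v)) same)
    in σ≡σ+t*total⇒≡ δ pos t e

module _ (D : ℕ → Set) {n′} (δ : Fin (suc n′) → ℕ) (pos : ∀ i → 0 < δ i) (s : ℕ → ℕ)
         (s-step : ∀ l → s (suc l) ≡ s l + δ (l mod suc n′)) where

  open import Data.Integer as ℤ using (+_)
  import Data.Integer.Properties as ℤP
  open IntegerArithmetic
  open PeriodicSequence δ s s-step
  open Colouring δ pos

  dSequence⇒colouring : IsDSequence D s → IsColoring D (total δ) (suc n′) (colorMap δ pos)
  dSequence⇒colouring dseq = colour-count , disjoint
    where
    colour-count : ∀ v → Sub.∣ colorMap δ pos v ∣ ≡ suc n′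
    colour-count v = trans (cong Sub.∣_∣ (colorMap≡image v)) (∣image∣≡n (colour v) (colour-injective v))

    no-shared-colour : ∀ {u v} i j → v ℤ.≤ u → Adj D u v → colour u i ≢ colour v j
    no-shared-colour {u} {v} i j v≤u adj same =
      let t , e = colour-coincidence v (ℤ.∣ u ℤ.- v ∣) i j
                    (subst (λ w → colour w i ≡ colour v j) (i≤j⇒j≡i+∣j-i∣ v≤u) same)
      in dseq (suc (toℕ i)) _ (subst D (sym (distance-realised i j t e)) adj)

    disjoint : ∀ u v → Adj D u v → Sub.Empty (colorMap δ pos u ∩ colorMap δ pos v)
    disjoint u v adj (x , x∈u∩v) with x∈p∩q⁻ (colorMap δ pos u) (colorMap δ pos v) x∈u∩v
    ... | x∈u , x∈v with ∈-colorMap⁻ u x∈u | ∈-colorMap⁻ v x∈v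
    ...   | i , x≡ui | j , x≡vj with ℤP.≤-total v u
    ...     | inj₁ v≤u = no-shared-colour i j v≤u adj (trans (sym x≡ui) x≡vj)
    ...     | inj₂ u≤v =
      no-shared-colour j i u≤v (subst D (ℤP.∣i-j∣≡∣j-i∣ u v) adj) (trans (sym x≡vj) x≡ui)

  colouring⇒dSequence : IsColoring D (total δ) (suc n′) (colorMap δ pos) → IsDSequence D s
  colouring⇒dSequence (_ , disjoint) k l dkl with s-residue k | s-residue l
  ... | i , q , ek | j , r , el =
    disjoint (+ s k) (+ s l) adj (colour (+ s k) j , x∈p∩q⁺ (∈-colorMap⁺ (+ s k) j , shared∈))
    where
    open ≡-Reasoning
    adj : Adj D (+ s k) (+ s l)
    adj = subst D (sym (∣+m-+n∣≡∣m-n∣ (s k) (s l))) dkl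
    shared : colour (+ s k) j ≡ colour (+ s l) i
    shared = toℕ-injective (begin
      toℕ (colour (+ s k) j)        ≡⟨ toℕ-colour (+ s k) j ⟩
      (s k + σ δ j) % total δ       ≡⟨ %-shift q ek (σ δ j) ⟩
      (s 0 + σ δ i + σ δ j) % total δ ≡⟨ cong (_% total δ) (xy∙z≈xz∙y (s 0) (σ δ i) (σ δ j)) ⟩
      (s 0 + σ δ j + σ δ i) % total δ ≡⟨ %-shift r el (σ δ i) ⟨
      (s l + σ δ i) % total δ       ≡⟨ toℕ-colour (+ s l) i ⟨
      toℕ (colour (+ s l) i)        ∎)
    shared∈ : colour (+ s k) j ∈ colorMap δ pos (+ s l)
    shared∈ = subst (_∈ colorMap δ pos (+ s l)) (sym shared) (∈-colorMap⁺ (+ s l) i)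

proposition1 : (D : ℕ → Set) (n : ℕ) .{{_ : NonZero n}} (δ : Fin n → ℕ)
               (pos : ∀ i → 0 < δ i) (s : ℕ → ℕ) →
               (∀ l → s (suc l) ≡ s l + δ (l mod n)) →
               IsDSequence D s ⇔ IsColoring D (total δ) n (colorMap δ pos)
-- there is no clause for n = 0, as NonZero 0 is empty
proposition1 D (suc n′) δ pos s s-step =
  mk⇔ (dSequence⇒colouring D δ pos s s-step) (colouring⇒dSequence D δ pos s s-step)
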